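{- For any finite simple graph $G$, $\iota(\mathrm{Mid}(G))=\tau(G)$.
   Context: For a graph $H$ and $S\subseteq V(H)$, let $N_H[S]$ be $S$ together with all vertices adjacent to a vertex of $S$. A set $S\subseteq V(H)$ is an isolating set of $H$ if $V(H)\setminus N_H[S]$ is an independent set of $H$; $\iota(H)$ is the minimum size of an isolating set of $H$. The middle graph $\mathrm{Mid}(G)$ has vertex set $V(G)\cup\{m_e: e\in E(G)\}$, with $v\sim m_e$ iff $v$ is an endpoint of $e$, $m_e\sim m_f$ iff distinct edges $e,f$ share an endpoint, and no edges between vertices of $V(G)$. For $E_0\subseteq E(G)$, $V(E_0)$ is the set of endpoints of edges in $E_0$; $\tau(G)$ is the minimum of $|E_0|$ over all $E_0\subseteq E(G)$ such that $V(G)\setminus V(E_0)$ is an independent set of $G$. -}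

module Defs where

open import Data.Nat using (ℕ; _≤_)
open import Data.Fin using (Fin; _<_)
open import Data.Bool using (Bool; T)
open import Data.Empty using (⊥)
open import Data.Sum using (_⊎_; inj₁; inj₂)
open import Data.Product using (Σ; ∃; ∃-syntax; _×_; _,_)
open import Data.List using (List; length)
open import Data.List.Membership.Propositional using (_∈_; _∉_)
open import Data.List.Relation.Unary.Unique.Propositional using (Unique)
open import Relation.Nullary using (¬_)
open import Relation.Binary.PropositionalEquality using (_≡_; _≢_)

record Graph : Set₁ where
  field
    V   : Set
    _~_ : V → V → Set

record SimpleGraph : Set where
  field
    n     : ℕ
    adj   : Fin n → Fin n → Bool
    sym   : ∀ u v → T (adj u v) → T (adj v u)
    irrefl : ∀ v → ¬ T (adj v v)

-- Minimum: k is the least length of a duplicate-free list (= finite set)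
-- satisfying P.
IsMin : {A : Set} → (List A → Set) → ℕ → Set
IsMin {A} P k =
  (∃[ S ] (Unique S × P S × length S ≡ k)) ×
  (∀ (S : List A) → Unique S → P S → k ≤ length S)

module _ (H : Graph) where
  open Graph H

  InClosedNbhd : List V → V → Set
  InClosedNbhd S v = v ∈ S ⊎ (∃[ u ] (u ∈ S × u ~ v))

  Isolating : List V → Set
  Isolating S = ∀ u v → ¬ InClosedNbhd S u → ¬ InClosedNbhd S v → ¬ (u ~ v)

  IsIota : ℕ → Set
  IsIota = IsMin Isolating

module _ (G : SimpleGraph) where
  open SimpleGraph G

  -- edges {i,j}, represented canonically with i < j
  Edge : Set
  Edge = Σ (Fin n × Fin n) λ { (i , j) → i < j × T (adj i j) }

  Endpoint : Fin n → Edge → Set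
  Endpoint v ((i , j) , _) = v ≡ i ⊎ v ≡ j

  MidAdj : Fin n ⊎ Edge → Fin n ⊎ Edge → Set
  MidAdj (inj₁ v) (inj₁ w) = ⊥
  MidAdj (inj₁ v) (inj₂ e) = Endpoint v e
  MidAdj (inj₂ e) (inj₁ v) = Endpoint v e
  MidAdj (inj₂ e) (inj₂ f) = e ≢ f × (∃[ v ] (Endpoint v e × Endpoint v f))

  Mid : Graph
  Mid = record { V = Fin n ⊎ Edge ; _~_ = MidAdj }

  InVE : List Edge → Fin n → Set
  InVE E₀ v = ∃[ e ] (e ∈ E₀ × Endpoint v e)

  EdgeIsolating : List Edge → Set
  EdgeIsolating E₀ = ∀ u v → ¬ InVE E₀ u → ¬ InVE E₀ v → ¬ T (adj u v)

  IsTau : ℕ → Set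
  IsTau = IsMin EdgeIsolating

module Submission where

-- If V(G) ∖ V(E₀) is independent, every edge vertex m_f of Mid(G) is dominated by
-- {m_e : e ∈ E₀}: otherwise both ends of f avoid V(E₀) although they are adjacent.
-- Conversely, replace each vertex of an isolating set S by an incident edge and each
-- m_e by e; this gives at most |S| edges, and an edge ab with both ends uncovered would
-- make a and m_ab two adjacent vertices outside N[S].

open import Data.Bool using (T)
open import Data.Bool.Properties using (T-irrelevant; T?)
open import Data.Empty using (⊥-elim)
open import Data.Fin using (Fin; _<_; _≟_)
open import Data.Fin.Properties using (<-cmp; <-irrelevant; _<?_; all?)
open import Data.List using (List; []; _∷_; length; filter; map; concatMap; cartesianProduct; cartesianProductWith; upTo; allFin; deduplicate)
open import Data.List.Extrema.Nat using (argmin; argmin-all; f[argmin]≤f[⊤]; f[argmin]≤f[xs])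
open import Data.List.Membership.Propositional using (_∈_; find; lose)
open import Data.List.Membership.Propositional.Properties using (∈-map⁺; ∈-concatMap⁺; ∈-cartesianProductWith⁺; ∈-cartesianProduct⁺; ∈-upTo⁺; ∈-allFin; ∈-filter⁺; ∈-deduplicate⁺)
open import Data.List.Properties using (length-map; length-deduplicate; length-++)
open import Data.List.Relation.Binary.Subset.Propositional using (_⊆_)
open import Data.List.Relation.Unary.All as All using (All)
open import Data.List.Relation.Unary.All.Properties using (all-filter)
open import Data.List.Relation.Unary.Any using (here; there; any?)
open import Data.List.Relation.Unary.Unique.Propositional using (Unique)
open import Data.List.Relation.Unary.Unique.Propositional.Properties as Unique using ()
open import Data.List.Relation.Unary.Unique.DecPropositional.Properties using (deduplicate-!)
open import Data.Nat using (ℕ; zero; suc; _≤_; z≤n; s≤s)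
open import Data.Nat.Properties using (≤-refl; ≤-trans; ≤-total; +-mono-≤)
open import Data.Product using (Σ; ∃-syntax; _×_; _,_; proj₁)
open import Data.Product.Properties as Product using ()
open import Data.Sum using (_⊎_; inj₁; inj₂; swap)
open import Data.Sum.Properties using (inj₂-injective)
open import Relation.Binary.Definitions using (DecidableEquality; tri<; tri≈; tri>)
open import Relation.Binary.PropositionalEquality using (_≡_; refl; cong; cong₂)
open import Relation.Nullary using (¬_; Dec; yes; no; ¬?; Irrelevant)
import Relation.Nullary.Decidable as Dec
open import Relation.Nullary.Decidable using (_×-dec_; _⊎-dec_; _→-dec_)
open import Relation.Unary using (Decidable)

open import Function using (_∘_)

open import Defs

module _ {A : Set} where

  listsOfLength : List A → ℕ → List (List A)
  listsOfLength xs zero    = [] ∷ []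
  listsOfLength xs (suc k) = cartesianProductWith _∷_ xs (listsOfLength xs k)

  ∈-listsOfLength : ∀ {xs} → (∀ x → x ∈ xs) → ∀ ys → ys ∈ listsOfLength xs (length ys)
  ∈-listsOfLength enum []       = here refl
  ∈-listsOfLength enum (y ∷ ys) = ∈-cartesianProductWith⁺ _∷_ (enum y) (∈-listsOfLength enum ys)

  listsOfLengthAtMost : List A → ℕ → List (List A)
  listsOfLengthAtMost xs n = concatMap (listsOfLength xs) (upTo (suc n))

  ∈-listsOfLengthAtMost : ∀ {xs n} → (∀ x → x ∈ xs) → ∀ ys → length ys ≤ n →
                          ys ∈ listsOfLengthAtMost xs n
  ∈-listsOfLengthAtMost {xs} enum ys |ys|≤n =
    ∈-concatMap⁺ (listsOfLength xs) (lose (∈-upTo⁺ (s≤s |ys|≤n)) (∈-listsOfLength enum ys))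

module Shortest {A : Set} (_≟ᴬ_ : DecidableEquality A) {xs : List A} (enum : ∀ x → x ∈ xs)
                {P : List A → Set} (P? : Decidable P) (P-mono : ∀ {S S′} → S ⊆ S′ → P S → P S′) where

  -- Any list longer than W is beaten by W itself, so only boundedly many lists need comparing.
  shortest : ∀ {W} → P W → Σ (List A) λ M → P M × (∀ S → P S → length M ≤ length S)
  shortest {W} pW = M , argmin-all length pW (all-filter P? candidates) , M-shortest
    where
    candidates : List (List A)
    candidates = listsOfLengthAtMost xs (length W)
    M : List A
    M = argmin length W (filter P? candidates)
    M-shortest : ∀ S → P S → length M ≤ length S
    M-shortest S pS with ≤-total (length S) (length W)
    ... | inj₁ |S|≤|W| = All.lookup (f[argmin]≤f[xs] {f = length} W (filter P? candidates))
                           (∈-filter⁺ P? (∈-listsOfLengthAtMost enum S |S|≤|W|) pS)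
    ... | inj₂ |W|≤|S| = ≤-trans (f[argmin]≤f[⊤] {f = length} W (filter P? candidates)) |W|≤|S|

  shortest-unique : ∀ {W} → P W → Σ (List A) λ M → Unique M × P M × (∀ S → P S → length M ≤ length S)
  shortest-unique pW with M , pM , M-shortest ← shortest pW =
    deduplicate _≟ᴬ_ M , deduplicate-! _≟ᴬ_ M , P-mono (∈-deduplicate⁺ _≟ᴬ_) pM ,
    λ S pS → ≤-trans (length-deduplicate _≟ᴬ_ M) (M-shortest S pS)

module _ {A : Set} {P : A → Set} (P? : Decidable P) where

  witnesses : List A → List (Σ A P)
  witnesses [] = []
  witnesses (a ∷ as) with P? a
  ... | yes p = (a , p) ∷ witnesses as
  ... | no _  = witnesses as

  ∈-witnesses : (∀ {a} → Irrelevant (P a)) → ∀ {a as} → a ∈ as → (p : P a) → (a , p) ∈ witnesses as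
  ∈-witnesses irr {as = x ∷ _} a∈x∷xs p with P? x | a∈x∷xs
  ... | yes q | here refl  = here (cong (x ,_) (irr p q))
  ... | yes _ | there a∈xs = there (∈-witnesses irr a∈xs p)
  ... | no ¬q | here refl  = ⊥-elim (¬q p)
  ... | no _  | there a∈xs = ∈-witnesses irr a∈xs p

length-concatMap-≤ : {A B : Set} {f : A → List B} → (∀ x → length (f x) ≤ 1) →
                     ∀ xs → length (concatMap f xs) ≤ length xs
length-concatMap-≤ f≤1 []       = z≤n
length-concatMap-≤ {f = f} f≤1 (x ∷ xs) rewrite length-++ (f x) {concatMap f xs} =
  +-mono-≤ (f≤1 x) (length-concatMap-≤ f≤1 xs)

module _ (G : SimpleGraph) where
  open SimpleGraph G renaming (sym to adj-sym)

  edges : List (Edge G)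
  edges = witnesses (λ (i , j) → (i <? j) ×-dec T? (adj i j)) (cartesianProduct (allFin n) (allFin n))

  isEdge-irrelevant : ∀ {i j : Fin n} → Irrelevant (i < j × T (adj i j))
  isEdge-irrelevant (p , q) (p′ , q′) = cong₂ _,_ (<-irrelevant p p′) (T-irrelevant q q′)

  ∈-edges : ∀ e → e ∈ edges
  ∈-edges ((i , j) , e) = ∈-witnesses _ isEdge-irrelevant (∈-cartesianProduct⁺ (∈-allFin i) (∈-allFin j)) e

  _≟ₑ_ : DecidableEquality (Edge G)
  _≟ₑ_ = Product.≡-dec (Product.≡-dec _≟_ _≟_) (λ p q → yes (isEdge-irrelevant p q))

  endpoint? : ∀ v e → Dec (Endpoint G v e)
  endpoint? v ((i , j) , _) = (v ≟ i) ⊎-dec (v ≟ j)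

  inVE? : ∀ E₀ v → Dec (InVE G E₀ v)
  inVE? E₀ v = Dec.map′ find (λ (e , e∈E₀ , v∈e) → lose e∈E₀ v∈e) (any? (endpoint? v) E₀)

  edgeIsolating? : Decidable (EdgeIsolating G)
  edgeIsolating? E₀ = all? λ u → all? λ v →
    ¬? (inVE? E₀ u) →-dec ¬? (inVE? E₀ v) →-dec ¬? (T? (adj u v))

  edgeIsolating-mono : ∀ {E₀ E₁} → E₀ ⊆ E₁ → EdgeIsolating G E₀ → EdgeIsolating G E₁
  edgeIsolating-mono E₀⊆E₁ iso u v u∉ v∉ =
    iso u v (λ (e , e∈ , u∈e) → u∉ (e , E₀⊆E₁ e∈ , u∈e)) (λ (e , e∈ , v∈e) → v∉ (e , E₀⊆E₁ e∈ , v∈e))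

  edgeBetween : ∀ a b → T (adj a b) →
                Σ (Edge G) λ f → Endpoint G a f × Endpoint G b f × (∀ w → Endpoint G w f → w ≡ a ⊎ w ≡ b)
  edgeBetween a b ab with <-cmp a b
  ... | tri< a<b _ _ = ((a , b) , a<b , ab) , inj₁ refl , inj₂ refl , λ _ w∈f → w∈f
  ... | tri≈ _ refl _ = ⊥-elim (irrefl a ab)
  ... | tri> _ _ b<a = ((b , a) , b<a , adj-sym a b ab) , inj₂ refl , inj₁ refl , λ _ w∈f → swap w∈f

  edges-edgeIsolating : EdgeIsolating G edges
  edges-edgeIsolating u v u∉ _ uv with f , u∈f , _ ← edgeBetween u v uv = u∉ (f , ∈-edges f , u∈f)

  shortestEdgeIsolating : Σ (List (Edge G)) λ E₀ →
    Unique E₀ × EdgeIsolating G E₀ × (∀ E₁ → EdgeIsolating G E₁ → length E₀ ≤ length E₁)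
  shortestEdgeIsolating =
    Shortest.shortest-unique _≟ₑ_ ∈-edges edgeIsolating? edgeIsolating-mono edges-edgeIsolating

  edgeVertex-dominated : ∀ {E₀} → EdgeIsolating G E₀ → ∀ f → ¬ ¬ InClosedNbhd (Mid G) (map inj₂ E₀) (inj₂ f)
  edgeVertex-dominated {E₀} iso f@((i , j) , _ , ij) f∉N =
    iso i j (endpoint-uncovered (inj₁ refl)) (endpoint-uncovered (inj₂ refl)) ij
    where
    endpoint-uncovered : ∀ {w} → Endpoint G w f → ¬ InVE G E₀ w
    endpoint-uncovered w∈f (e , e∈E₀ , w∈e) with e ≟ₑ f
    ... | yes refl = f∉N (inj₁ (∈-map⁺ inj₂ e∈E₀))
    ... | no e≢f   = f∉N (inj₂ (inj₂ e , ∈-map⁺ inj₂ e∈E₀ , e≢f , _ , w∈e , w∈f))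

  edgeIsolating⇒isolating : ∀ {E₀} → EdgeIsolating G E₀ → Isolating (Mid G) (map inj₂ E₀)
  edgeIsolating⇒isolating iso (inj₁ _) (inj₁ _) _ _ ()
  edgeIsolating⇒isolating iso (inj₁ _) (inj₂ f) _ f∉N _ = edgeVertex-dominated iso f f∉N
  edgeIsolating⇒isolating iso (inj₂ e) _ e∉N _ _ = edgeVertex-dominated iso e e∉N

  dominated-edgeVertex : ∀ {S f} → InClosedNbhd (Mid G) S (inj₂ f) →
                         ∃[ w ] (Endpoint G w f × InClosedNbhd (Mid G) S (inj₁ w))
  dominated-edgeVertex {f = f@((i , _) , _)} (inj₁ f∈S) = i , inj₁ refl , inj₂ (inj₂ f , f∈S , inj₁ refl)
  dominated-edgeVertex (inj₂ (inj₁ w , w∈S , w∈f)) = w , w∈f , inj₁ w∈S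
  dominated-edgeVertex (inj₂ (inj₂ e , e∈S , _ , w , w∈e , w∈f)) = w , w∈f , inj₂ (inj₂ e , e∈S , w∈e)

  chosenEdges : Fin n ⊎ Edge G → List (Edge G)
  chosenEdges (inj₁ v) with any? (endpoint? v) edges
  ... | yes v∈some = proj₁ (find v∈some) ∷ []
  ... | no _       = []
  chosenEdges (inj₂ e) = e ∷ []

  length-chosenEdges : ∀ x → length (chosenEdges x) ≤ 1
  length-chosenEdges (inj₁ v) with any? (endpoint? v) edges
  ... | yes _ = ≤-refl
  ... | no _  = z≤n
  length-chosenEdges (inj₂ e) = ≤-refl

  chosenEdges-covers : ∀ {v} e → Endpoint G v e → InVE G (chosenEdges (inj₁ v)) v
  chosenEdges-covers {v} e v∈e with any? (endpoint? v) edges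
  ... | yes v∈some = let (e′ , _ , v∈e′) = find v∈some in e′ , here refl , v∈e′
  ... | no v∈none  = ⊥-elim (v∈none (lose (∈-edges e) v∈e))

  toEdges : List (Fin n ⊎ Edge G) → List (Edge G)
  toEdges = concatMap chosenEdges

  length-toEdges : ∀ S → length (toEdges S) ≤ length S
  length-toEdges = length-concatMap-≤ length-chosenEdges

  toEdges-covers : ∀ {S x v} → x ∈ S → InVE G (chosenEdges x) v → InVE G (toEdges S) v
  toEdges-covers x∈S (e , e∈ , v∈e) = e , ∈-concatMap⁺ chosenEdges (lose x∈S e∈) , v∈e

  dominated-vertex-covered : ∀ {S w} f → Endpoint G w f →
                             InClosedNbhd (Mid G) S (inj₁ w) → InVE G (toEdges S) w
  dominated-vertex-covered f w∈f (inj₁ w∈S) = toEdges-covers w∈S (chosenEdges-covers f w∈f)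
  dominated-vertex-covered _ _ (inj₂ (inj₂ e , e∈S , w∈e)) = toEdges-covers e∈S (e , here refl , w∈e)

  isolating⇒edgeIsolating : ∀ {S} → Isolating (Mid G) S → EdgeIsolating G (toEdges S)
  isolating⇒edgeIsolating {S} iso a b a∉ b∉ ab with f , a∈f , _ , f⊆ab ← edgeBetween a b ab =
    iso (inj₁ a) (inj₂ f) (a∉ ∘ dominated-vertex-covered f a∈f) f-undominated a∈f
    where
    f-undominated : ¬ InClosedNbhd (Mid G) S (inj₂ f)
    f-undominated f∈N with w , w∈f , w∈N ← dominated-edgeVertex f∈N | f⊆ab w w∈f
    ... | inj₁ refl = a∉ (dominated-vertex-covered f w∈f w∈N)
    ... | inj₂ refl = b∉ (dominated-vertex-covered f w∈f w∈N)

proposition1 : (G : SimpleGraph) → ∃[ k ] (IsIota (Mid G) k × IsTau G k)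
proposition1 G with E₀ , E₀-unique , E₀-iso , E₀-shortest ← shortestEdgeIsolating G =
  length E₀ , ι , τ
  where
  ι : IsIota (Mid G) (length E₀)
  ι = ( map inj₂ E₀ , Unique.map⁺ inj₂-injective E₀-unique
      , edgeIsolating⇒isolating G E₀-iso , length-map inj₂ E₀ )
    , λ S _ S-iso → ≤-trans (E₀-shortest (toEdges G S) (isolating⇒edgeIsolating G S-iso))
                            (length-toEdges G S)
  τ : IsTau G (length E₀)
  τ = (E₀ , E₀-unique , E₀-iso , refl) , λ E₁ _ → E₀-shortest E₁
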